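{- Let $p$ be an odd prime and $q=p^r$ with $r\geq 1$. Let $d\geq 2$ be an integer with $p\nmid d$. Then for all integers $1\leq a\leq q-2$ and $0\leq i\leq r-1$, $$\left\lfloor\frac{ap^i}{q-1}\right\rfloor+\left\lfloor\frac{ -dap^i}{q-1}\right\rfloor=\sum_{h=1}^{d-1}\left\lfloor\left\langle\frac{hp^i}{d}\right\rangle-\frac{ap^i}{q-1}\right\rfloor-1.$$
   Context: For $x\in\mathbb{Q}$, $\lfloor x\rfloor$ denotes the greatest integer $\leq x$ and $\langle x\rangle=x-\lfloor x\rfloor$ denotes the fractional part. -}

module Defs where

open import Data.Nat using (ℕ; zero; suc)
open import Data.Integer using (ℤ)
open import Data.Rational using (ℚ; _/_; _-_; floor; _+_; 0ℚ)

fract : ℚ → ℚ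
fract x = x - (floor x / 1)

-- the rational number n / m for an integer n and a positive natural m;
-- (only ever used with m ≥ 1; the m = 0 case is a dummy value)
_//_ : ℤ → ℕ → ℚ
n // zero = 0ℚ
n // suc m = n / suc m

sumFrom1 : ℕ → (ℕ → ℤ) → ℤ
sumFrom1 zero f = Data.Integer.+ 0
sumFrom1 (suc k) f = sumFrom1 k f Data.Integer.+ f (suc k)

-- Write N = q − 1, P = p^i and A = aP. For r = hP mod d one has
-- ⟨hP/d⟩ − A/N = (rN − dA)/(dN), and since p ∤ d, P is invertible mod d, so
-- h ↦ hP mod d permutes {0, …, d − 1}. Summing over h = 0, …, d − 1 therefore
-- gives Σ_{j<d} ⌊(jN − dA)/(dN)⌋, which is ⌊−dA/N⌋ by Hermite's identity.
-- The extra term h = 0 is ⌊−A/N⌋ = −⌊A/N⌋ − 1, because N ∤ A: N is prime to p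
-- (p ∣ N + 1) and 0 < a < N.

module Submission where

module FloorDivision where

  open import Data.Nat.Base as ℕ using (suc)
  open import Data.Nat.DivMod using (m<n⇒m/n≡0)
  open import Data.Nat.Divisibility using (_∣_; divides)
  open import Data.Integer.Base as ℤ using (+_; -_; _+_; _-_; _*_; _/_; _≤_; _<_; 1ℤ; ∣_∣)
  open import Data.Integer.Properties
  open import Data.Integer.DivMod using ([n/d]*d≤n; n<s[n/ℕd]*d; div-pos-is-/ℕ)
  open import Data.Integer.Solver using (module +-*-Solver)
  open import Relation.Nullary using (¬_)
  open import Relation.Binary.PropositionalEquality
  open +-*-Solver

  n<[n/d+1]*d : ∀ n m → n < (n / + suc m + 1ℤ) * + suc m
  n<[n/d+1]*d n m = subst (λ q → n < q * + suc m)
    (trans (+-comm 1ℤ (n ℤ./ℕ suc m)) (cong (_+ 1ℤ) (sym (div-pos-is-/ℕ n (suc m)))))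
    (n<s[n/ℕd]*d n (suc m))

  i<j+1⇒i≤j : ∀ {i j} → i < j + 1ℤ → i ≤ j
  i<j+1⇒i≤j {i} {j} i<j+1 =
    subst (i ≤_) (trans (cong ℤ.pred (+-comm j 1ℤ)) (pred-suc j)) (i<j⇒i≤pred[j] i<j+1)

  /-unique : ∀ {n k} m → k * + suc m ≤ n → n < (k + 1ℤ) * + suc m → n / + suc m ≡ k
  /-unique {n} m k*d≤n n<[k+1]*d = ≤-antisym
    (i<j+1⇒i≤j (*-cancelʳ-<-nonNeg (+ suc m) (≤-<-trans ([n/d]*d≤n n (+ suc m)) n<[k+1]*d)))
    (i<j+1⇒i≤j (*-cancelʳ-<-nonNeg (+ suc m) (≤-<-trans k*d≤n (n<[n/d+1]*d n m))))

  /-cross : ∀ a n b e → a * + suc e ≡ n * + suc b → a / + suc b ≡ n / + suc e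
  /-cross a n b e a*e≡n*b = sym (/-unique e
    (*-cancelʳ-≤-pos (q * E) n B
      (subst₂ _≤_ (swap q) a*e≡n*b (*-monoʳ-≤-nonNeg E ([n/d]*d≤n a B))))
    (*-cancelʳ-<-nonNeg B
      (subst₂ _<_ a*e≡n*b (swap (q + 1ℤ)) (*-monoʳ-<-pos E (n<[n/d+1]*d a b)))))
    where
    B = + suc b
    E = + suc e
    q = a / B
    swap : ∀ k → k * B * E ≡ k * E * B
    swap k = solve 3 (λ k B E → k :* B :* E := k :* E :* B) refl k B E

  [n+d]/d≡n/d+1 : ∀ n m → (n + + suc m) / + suc m ≡ n / + suc m + 1ℤ
  [n+d]/d≡n/d+1 n m = /-unique m
    (subst (_≤ n + D) (shift q) (+-monoˡ-≤ D ([n/d]*d≤n n D)))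
    (subst (n + D <_) (shift (q + 1ℤ)) (+-monoˡ-< D (n<[n/d+1]*d n m)))
    where
    D = + suc m
    q = n / D
    shift : ∀ k → k * D + D ≡ (k + 1ℤ) * D
    shift k = solve 2 (λ k D → k :* D :+ D := (k :+ con 1ℤ) :* D) refl k D

  [-n]/d≡-[n/d]-1 : ∀ n m → ¬ (suc m ∣ ∣ n ∣) → (- n) / + suc m ≡ - (n / + suc m) - 1ℤ
  [-n]/d≡-[n/d]-1 n m d∤n = /-unique m
    (subst (_≤ - n) (solve 2 (λ q D → :- ((q :+ con 1ℤ) :* D) := (:- q :- con 1ℤ) :* D) refl q D)
      (neg-mono-≤ (<⇒≤ (n<[n/d+1]*d n m))))
    (subst (- n <_) (solve 2 (λ q D → :- (q :* D) := (:- q :- con 1ℤ :+ con 1ℤ) :* D) refl q D)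
      (neg-mono-< (≤∧≢⇒< ([n/d]*d≤n n D) q*d≢n)))
    where
    D = + suc m
    q = n / D
    q*d≢n : q * D ≢ n
    q*d≢n q*d≡n = d∤n (divides ∣ q ∣ (trans (cong ∣_∣ (sym q*d≡n)) (abs-* q D)))

  n<d⇒n/d≡0 : ∀ {n} m → n ℕ.< suc m → + n / + suc m ≡ + 0
  n<d⇒n/d≡0 {n} m n<d = trans (div-pos-is-/ℕ (+ n) (suc m)) (cong +_ (m<n⇒m/n≡0 n<d))

module RationalFloor where

  open import Data.Nat.Base as ℕ using (suc; _%_)
  open import Data.Integer.Base using (+_; -_; _+_; _*_; _/_)
  open import Data.Integer.Properties using (pos-*)
  open import Data.Integer.DivMod using (a≡a%n+[a/n]*n)
  open import Data.Integer.Solver using (module +-*-Solver)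
  open import Data.Rational.Base as ℚ using (mkℚ; floor; toℚᵘ)
  open import Data.Rational.Properties using (toℚᵘ-fromℚᵘ; toℚᵘ-homo-+; toℚᵘ-homo‿-)
  open import Data.Rational.Unnormalised.Base as ℚᵘ using (mkℚᵘ; *≡*) renaming (_≃_ to _≃ᵘ_)
  import Data.Rational.Unnormalised.Properties as ℚᵘ
  open import Relation.Binary.PropositionalEquality
  open import Defs
  open FloorDivision
  open +-*-Solver

  floor-≃ : ∀ x n m → toℚᵘ x ≃ᵘ mkℚᵘ n m → floor x ≡ n / + suc m
  floor-≃ (mkℚ a b _) n m (*≡* a*m≡n*b) = /-cross a n b m a*m≡n*b

  toℚᵘ-/ : ∀ n m → toℚᵘ (n ℚ./ suc m) ≃ᵘ mkℚᵘ n m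
  toℚᵘ-/ n m = toℚᵘ-fromℚᵘ (mkℚᵘ n m)

  floor-/ : ∀ n m → floor (n ℚ./ suc m) ≡ n / + suc m
  floor-/ n m = floor-≃ (n ℚ./ suc m) n m (toℚᵘ-/ n m)

  -- Cross-multiplied form of  k/d − ⌊k/d⌋ − A/N = (rN − dA)/(dN)  for  k = r + ⌊k/d⌋ d.
  fract-sub-cross : ∀ {k r F A B D N D₁ M M′} →
    k ≡ r + F * D → B ≡ - (D * A) → D₁ ≡ D * + 1 → M ≡ D * N → M′ ≡ D₁ * N →
    ((k * + 1 + (- F) * D) * N + (- A) * D₁) * M ≡ (r * N + B) * M′
  fract-sub-cross {r = r} {F} {A} {D = D} {N} refl refl refl refl refl =
    solve 5 (λ r F A D N →
      (((r :+ F :* D) :* con (+ 1) :+ (:- F) :* D) :* N :+ (:- A) :* (D :* con (+ 1))) :* (D :* N)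
        := (r :* N :+ :- (D :* A)) :* (D :* con (+ 1) :* N)) refl r F A D N

  floor[fract[k/d]-A/N] : ∀ k A e n →
    floor (fract ((+ k) // suc e) ℚ.- ((+ A) // suc n))
      ≡ (+ (k % suc e) * + suc n + - (+ (suc e ℕ.* A))) / + (suc e ℕ.* suc n)
  floor[fract[k/d]-A/N] k A e n = floor-≃ _ _ _ (begin
      toℚᵘ (x ℚ.- ⌊x⌋ ℚ.- y)
        ≈⟨ ℚᵘ.≃-trans (toℚᵘ-homo-+ (x ℚ.- ⌊x⌋) (ℚ.- y))
                      (ℚᵘ.+-cong (toℚᵘ-homo-+ x (ℚ.- ⌊x⌋)) (toℚᵘ-homo‿- y)) ⟩
      toℚᵘ x ℚᵘ.+ toℚᵘ (ℚ.- ⌊x⌋) ℚᵘ.- toℚᵘ y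
        ≈⟨ ℚᵘ.+-cong (ℚᵘ.+-cong (toℚᵘ-/ (+ k) e)
                                (ℚᵘ.≃-trans (toℚᵘ-homo‿- ⌊x⌋) (ℚᵘ.-‿cong (toℚᵘ-/ (floor x) 0))))
                     (ℚᵘ.-‿cong (toℚᵘ-/ (+ A) n)) ⟩
      mkℚᵘ (+ k) e ℚᵘ.- mkℚᵘ (floor x) 0 ℚᵘ.- mkℚᵘ (+ A) n
        ≈⟨ *≡* (fract-sub-cross {r = + (k % suc e)} {floor x} {+ A} {D = + suc e} {+ suc n}
                 k≡r+⌊x⌋*d (cong -_ (pos-* (suc e) A)) (pos-* (suc e) 1)
                 (pos-* (suc e) (suc n)) (pos-* (suc e ℕ.* 1) (suc n))) ⟩
      mkℚᵘ (+ (k % suc e) * + suc n + - (+ (suc e ℕ.* A))) (n ℕ.+ e ℕ.* suc n) ∎)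
    where
    open ℚᵘ.≃-Reasoning
    x = (+ k) // suc e
    y = (+ A) // suc n
    ⌊x⌋ = floor x ℚ./ 1
    k≡r+⌊x⌋*d : + k ≡ + (k % suc e) + floor x * + suc e
    k≡r+⌊x⌋*d = subst (λ F → + k ≡ + (k % suc e) + F * + suc e) (sym (floor-/ (+ k) e))
                  (a≡a%n+[a/n]*n (+ k) (+ suc e))

module FiniteSums where

  open import Data.Nat.Base using (ℕ; zero; suc)
  open import Data.Fin.Base using (toℕ; inject₁; fromℕ)
  open import Data.Fin.Properties using (toℕ-inject₁; toℕ-fromℕ)
  open import Data.Integer.Base using (ℤ; _+_)
  open import Data.Integer.Properties using (+-0-commutativeMonoid; +-identityˡ; +-identityʳ; +-assoc; +-comm)
  open import Algebra.Properties.CommutativeMonoid.Sum +-0-commutativeMonoid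
    using (sum-syntax; sum-cong-≗; sum-init-last)
  open import Relation.Binary.PropositionalEquality
  open import Defs using (sumFrom1)

  ∑-last : ∀ d (g : ℕ → ℤ) → ∑[ j < suc d ] g (toℕ j) ≡ ∑[ j < d ] g (toℕ j) + g d
  ∑-last d g = begin
    ∑[ j < suc d ] g (toℕ j)
      ≡⟨ sum-init-last {d} (λ j → g (toℕ j)) ⟩
    ∑[ j < d ] g (toℕ (inject₁ j)) + g (toℕ (fromℕ d))
      ≡⟨ cong₂ _+_ (sum-cong-≗ {d} (λ j → cong g (toℕ-inject₁ j))) (cong g (toℕ-fromℕ d)) ⟩
    ∑[ j < d ] g (toℕ j) + g d
      ∎
    where open ≡-Reasoning

  sumFrom1+f0≡∑ : ∀ e f → sumFrom1 e f + f 0 ≡ ∑[ j < suc e ] f (toℕ j)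
  sumFrom1+f0≡∑ zero f = trans (+-identityˡ (f 0)) (sym (+-identityʳ (f 0)))
  sumFrom1+f0≡∑ (suc e) f = begin
    sumFrom1 e f + f (suc e) + f 0       ≡⟨ +-assoc (sumFrom1 e f) (f (suc e)) (f 0) ⟩
    sumFrom1 e f + (f (suc e) + f 0)     ≡⟨ cong (sumFrom1 e f +_) (+-comm (f (suc e)) (f 0)) ⟩
    sumFrom1 e f + (f 0 + f (suc e))     ≡⟨ +-assoc (sumFrom1 e f) (f 0) (f (suc e)) ⟨
    sumFrom1 e f + f 0 + f (suc e)       ≡⟨ cong (_+ f (suc e)) (sumFrom1+f0≡∑ e f) ⟩
    ∑[ j < suc e ] f (toℕ j) + f (suc e) ≡⟨ ∑-last (suc e) f ⟨
    ∑[ j < suc (suc e) ] f (toℕ j)       ∎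
    where open ≡-Reasoning

module Hermite where

  open import Data.Nat.Base as ℕ using (ℕ; zero; suc)
  import Data.Nat.Properties as ℕ
  open import Data.Fin.Base using (toℕ)
  open import Data.Fin.Properties using (toℕ<n)
  open import Data.Integer.Base as ℤ using (ℤ; +_; -[1+_]; _+_; _*_; _/_; 0ℤ; 1ℤ)
  open import Data.Integer.Properties
  open import Data.Integer.DivMod using (a≡a%n+[a/n]*n; n%d<d)
  open import Data.Integer.Solver using (module +-*-Solver)
  open import Algebra.Bundles using (AbelianGroup)
  open import Algebra.Properties.Group (AbelianGroup.group +-0-abelianGroup) using (∙-cancelʳ)
  open import Algebra.Properties.CommutativeMonoid.Sum +-0-commutativeMonoid
    using (sum-syntax; sum-cong-≗; sum-replicate-zero)
  open import Relation.Binary.PropositionalEquality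
  open FloorDivision
  open FiniteSums
  open +-*-Solver

  sucℤ-injective : ∀ {i j} → ℤ.suc i ≡ ℤ.suc j → i ≡ j
  sucℤ-injective {i} {j} eq = trans (sym (pred-suc i)) (trans (cong ℤ.pred eq) (pred-suc j))

  suc-commuting⇒≗id : (φ : ℤ → ℤ) → φ 0ℤ ≡ 0ℤ → (∀ i → φ (ℤ.suc i) ≡ ℤ.suc (φ i)) →
                      ∀ i → φ i ≡ i
  suc-commuting⇒≗id φ φ0≡0 φ-suc = go
    where
    go : ∀ i → φ i ≡ i
    go (+ zero)     = φ0≡0
    go (+ suc n)    = trans (φ-suc (+ n)) (cong ℤ.suc (go (+ n)))
    go -[1+ zero ]  = sucℤ-injective (trans (sym (φ-suc -[1+ zero ])) φ0≡0)
    go -[1+ suc n ] = sucℤ-injective (trans (sym (φ-suc -[1+ suc n ])) (go -[1+ n ]))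

  -- With B = s + qN and 0 ≤ s < N, the left-hand side is a function φ of q. All its terms
  -- vanish at q = 0, and raising q by one shifts the summation index by one (g-suc),
  -- which changes the sum by g d − g 0 = 1 (g-last).
  hermite : ∀ e n B →
    ∑[ j < suc e ] ((+ toℕ j * + suc n + B) / + (suc e ℕ.* suc n)) ≡ B / + suc n
  hermite e n B = begin
    ∑[ j < d ] ((+ toℕ j * N + B) / M)
      ≡⟨ cong (λ B → ∑[ j < d ] ((+ toℕ j * N + B) / M)) (a≡a%n+[a/n]*n B N) ⟩
    φ (B / N)
      ≡⟨ suc-commuting⇒≗id φ φ0≡0 φ-suc (B / N) ⟩
    B / N
      ∎
    where
    open ≡-Reasoning
    d = suc e
    N = + suc n
    M = + (d ℕ.* suc n)
    s = B ℤ.% N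

    g : ℤ → ℕ → ℤ
    g q k = (+ k * N + (+ s + q * N)) / M

    φ : ℤ → ℤ
    φ q = ∑[ j < d ] g q (toℕ j)

    g0≡0 : ∀ k → k ℕ.< d → g 0ℤ k ≡ 0ℤ
    g0≡0 k k<d = trans (cong (_/ M) numerator) (n<d⇒n/d≡0 _ bound)
      where
      numerator : + k * N + (+ s + 0ℤ * N) ≡ + (k ℕ.* suc n ℕ.+ s)
      numerator = begin
        + k * N + (+ s + 0ℤ * N)  ≡⟨ cong (_+_ (+ k * N)) (+-identityʳ (+ s)) ⟩
        + k * N + + s             ≡⟨ cong (λ x → x + + s) (pos-* k (suc n)) ⟨
        + (k ℕ.* suc n) + + s     ≡⟨ pos-+ (k ℕ.* suc n) s ⟨
        + (k ℕ.* suc n ℕ.+ s)     ∎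
      bound : k ℕ.* suc n ℕ.+ s ℕ.< d ℕ.* suc n
      bound = ℕ.<-≤-trans (ℕ.+-monoʳ-< (k ℕ.* suc n) (n%d<d B N))
        (ℕ.≤-trans (ℕ.≤-reflexive (ℕ.+-comm (k ℕ.* suc n) (suc n))) (ℕ.*-monoˡ-≤ (suc n) k<d))

    φ0≡0 : φ 0ℤ ≡ 0ℤ
    φ0≡0 = trans (sum-cong-≗ {d} (λ j → g0≡0 (toℕ j) (toℕ<n j))) (sum-replicate-zero d)

    g-suc : ∀ q k → g (ℤ.suc q) k ≡ g q (suc k)
    g-suc q k = cong (_/ M) (solve 4 (λ k s q N →
      k :* N :+ (s :+ (con 1ℤ :+ q) :* N) := (con 1ℤ :+ k) :* N :+ (s :+ q :* N)) refl (+ k) (+ s) q N)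

    g-last : ∀ q → g q d ≡ g q 0 + 1ℤ
    g-last q = begin
      (+ d * N + X) / M    ≡⟨ cong (_/ M) (trans (cong (_+ X) (sym (pos-* d (suc n)))) (+-comm M X)) ⟩
      (X + M) / M          ≡⟨ [n+d]/d≡n/d+1 X (n ℕ.+ e ℕ.* suc n) ⟩
      X / M + 1ℤ           ≡⟨ cong (λ x → x / M + 1ℤ) (+-identityˡ X) ⟨
      g q 0 + 1ℤ           ∎
      where X = + s + q * N

    φ-suc : ∀ q → φ (ℤ.suc q) ≡ ℤ.suc (φ q)
    φ-suc q = ∙-cancelʳ (g q 0) _ _ (begin
      φ (ℤ.suc q) + g q 0                  ≡⟨ cong (_+ g q 0) (sum-cong-≗ {d} (λ j → g-suc q (toℕ j))) ⟩
      ∑[ j < d ] g q (suc (toℕ j)) + g q 0 ≡⟨ +-comm _ (g q 0) ⟩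
      ∑[ j < suc d ] g q (toℕ j)           ≡⟨ ∑-last d (g q) ⟩
      φ q + g q d                          ≡⟨ cong (_+_ (φ q)) (g-last q) ⟩
      φ q + (g q 0 + 1ℤ)                   ≡⟨ solve 2 (λ x y → x :+ (y :+ con 1ℤ) := (con 1ℤ :+ x) :+ y)
                                                       refl (φ q) (g q 0) ⟩
      ℤ.suc (φ q) + g q 0                  ∎)

module ModularPermutation where

  open import Data.Nat.Base using (ℕ; NonZero; _*_; _%_; _<_)
  open import Data.Nat.Properties using (*-assoc; *-comm; *-identityˡ)
  open import Data.Nat.DivMod using (%-distribˡ-*; m%n%n≡m%n; m%n<n; m<n⇒m%n≡m)
  open import Data.Fin.Base using (Fin; toℕ; fromℕ<)
  open import Data.Fin.Properties using (toℕ-fromℕ<; toℕ<n; toℕ-injective)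
  open import Data.Fin.Permutation using (Permutation; permutation; _⟨$⟩ʳ_)
  open import Data.Integer.Base using (ℤ)
  open import Data.Integer.Properties using (+-0-commutativeMonoid)
  open import Algebra.Properties.CommutativeMonoid.Sum +-0-commutativeMonoid
    using (sum-syntax; sum-cong-≗; sum-permute)
  open import Relation.Binary.PropositionalEquality

  [m%d*n]%d≡[m*n]%d : ∀ m n d .{{_ : NonZero d}} → ((m % d) * n) % d ≡ (m * n) % d
  [m%d*n]%d≡[m*n]%d m n d = begin
    ((m % d) * n) % d             ≡⟨ %-distribˡ-* (m % d) n d ⟩
    ((m % d % d) * (n % d)) % d   ≡⟨ cong (λ x → (x * (n % d)) % d) (m%n%n≡m%n m d) ⟩
    ((m % d) * (n % d)) % d       ≡⟨ %-distribˡ-* m n d ⟨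
    (m * n) % d                   ∎
    where open ≡-Reasoning

  *%-cancel : ∀ {d P Q x} .{{_ : NonZero d}} →
              (P * Q) % d ≡ 1 % d → x < d → ((x * P) % d * Q) % d ≡ x
  *%-cancel {d} {P} {Q} {x} PQ≡1 x<d = begin
    ((x * P) % d * Q) % d         ≡⟨ [m%d*n]%d≡[m*n]%d (x * P) Q d ⟩
    (x * P * Q) % d               ≡⟨ cong (_% d) (trans (*-assoc x P Q) (*-comm x (P * Q))) ⟩
    (P * Q * x) % d               ≡⟨ [m%d*n]%d≡[m*n]%d (P * Q) x d ⟨
    ((P * Q) % d * x) % d         ≡⟨ cong (λ y → (y * x) % d) PQ≡1 ⟩
    (1 % d * x) % d               ≡⟨ [m%d*n]%d≡[m*n]%d 1 x d ⟩
    (1 * x) % d                   ≡⟨ cong (_% d) (*-identityˡ x) ⟩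
    x % d                         ≡⟨ m<n⇒m%n≡m x<d ⟩
    x                             ∎
    where open ≡-Reasoning

  *% : ∀ {d} .{{_ : NonZero d}} → ℕ → Fin d → Fin d
  *% {d} P j = fromℕ< (m%n<n (toℕ j * P) d)

  toℕ-*% : ∀ {d} .{{_ : NonZero d}} P (j : Fin d) → toℕ (*% P j) ≡ (toℕ j * P) % d
  toℕ-*% {d} P j = toℕ-fromℕ< (m%n<n (toℕ j * P) d)

  *%-inverse : ∀ {d P Q} .{{_ : NonZero d}} → (P * Q) % d ≡ 1 % d → ∀ j → *% Q (*% P j) ≡ j
  *%-inverse {d} {P} {Q} PQ≡1 j = toℕ-injective (begin
    toℕ (*% Q (*% P j))          ≡⟨ toℕ-*% Q (*% P j) ⟩
    (toℕ (*% P j) * Q) % d       ≡⟨ cong (λ y → (y * Q) % d) (toℕ-*% P j) ⟩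
    ((toℕ j * P) % d * Q) % d    ≡⟨ *%-cancel PQ≡1 (toℕ<n j) ⟩
    toℕ j                        ∎)
    where open ≡-Reasoning

  *%-permutation : ∀ {d P Q} .{{_ : NonZero d}} → (P * Q) % d ≡ 1 % d → Permutation d d
  *%-permutation {d} {P} {Q} PQ≡1 = permutation (*% P) (*% Q) (*%-inverse QP≡1) (*%-inverse PQ≡1)
    where QP≡1 = trans (cong (_% d) (*-comm Q P)) PQ≡1

  ∑-*% : ∀ {d P Q} .{{_ : NonZero d}} → (P * Q) % d ≡ 1 % d →
         ∀ (G : ℕ → ℤ) → ∑[ j < d ] G ((toℕ j * P) % d) ≡ ∑[ j < d ] G (toℕ j)
  ∑-*% {d} {P} PQ≡1 G = begin
    ∑[ j < d ] G ((toℕ j * P) % d)                   ≡⟨ sum-cong-≗ {d} (λ j → cong G (toℕ-*% P j)) ⟨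
    ∑[ j < d ] G (toℕ (*%-permutation PQ≡1 ⟨$⟩ʳ j))  ≡⟨ sum-permute (λ j → G (toℕ j)) (*%-permutation PQ≡1) ⟨
    ∑[ j < d ] G (toℕ j)                             ∎
    where open ≡-Reasoning

module PrimeCoprimality where

  open import Data.Nat.Base using (zero; suc; NonZero; NonTrivial; nonTrivial⇒≢1; _+_; _*_; _^_; _%_)
  open import Data.Nat.Properties using (+-comm; *-comm; *-identityʳ)
  open import Data.Nat.DivMod using (%-distribˡ-*; [m+kn]%n≡m%n; [m+n]%n≡m%n)
  open import Data.Nat.Divisibility using (_∣_; ∣1⇒≡1; ∣m+n∣m⇒∣n)
  open import Data.Nat.Primality using (Prime; prime⇒irreducible)
  open import Data.Nat.Coprimality using (Coprime; coprime-Bézout; coprime-divisor)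
  open import Data.Nat.GCD using (module Bézout)
  open import Data.Nat.Solver using (module +-*-Solver)
  open import Data.Product using (∃; _,_)
  open import Data.Sum using (inj₁; inj₂)
  open import Relation.Nullary using (¬_; contradiction)
  open import Relation.Binary.PropositionalEquality
  open +-*-Solver

  ∣suc⇒∤ : ∀ {p n} .{{_ : NonTrivial p}} → p ∣ suc n → ¬ (p ∣ n)
  ∣suc⇒∤ {p} {n} p∣1+n p∣n =
    nonTrivial⇒≢1 (∣1⇒≡1 (∣m+n∣m⇒∣n (subst (p ∣_) (+-comm 1 n) p∣1+n) p∣n))

  prime∤⇒coprime : ∀ {p m} → Prime p → ¬ (p ∣ m) → Coprime p m
  prime∤⇒coprime pr p∤m (k∣p , k∣m) with prime⇒irreducible pr k∣p
  ... | inj₁ k≡1  = k≡1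
  ... | inj₂ refl = contradiction k∣m p∤m

  coprime⇒%-inverse : ∀ {m e} → Coprime m (suc e) → ∃ λ x → (m * x) % suc e ≡ 1 % suc e
  coprime⇒%-inverse {m} {e} m⊥d with coprime-Bézout m⊥d
  ... | Bézout.+- x y 1+y*d≡x*m = x , (begin
    (m * x) % suc e          ≡⟨ cong (_% suc e) (trans (*-comm m x) (sym 1+y*d≡x*m)) ⟩
    (1 + y * suc e) % suc e  ≡⟨ [m+kn]%n≡m%n 1 y (suc e) ⟩
    1 % suc e                ∎)
    where open ≡-Reasoning
  ... | Bézout.-+ x y 1+x*m≡y*d = x * e , (begin
    (m * (x * e)) % suc e          ≡⟨ [m+n]%n≡m%n (m * (x * e)) (suc e) ⟨
    (m * (x * e) + suc e) % suc e  ≡⟨ cong (_% suc e) m*[x*e]+d≡1+y*e*d ⟩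
    (1 + y * e * suc e) % suc e    ≡⟨ [m+kn]%n≡m%n 1 (y * e) (suc e) ⟩
    1 % suc e                      ∎)
    where
    open ≡-Reasoning
    m*[x*e]+d≡1+y*e*d : m * (x * e) + suc e ≡ 1 + y * e * suc e
    m*[x*e]+d≡1+y*e*d = begin
      m * (x * e) + suc e  ≡⟨ solve 3 (λ m x e → m :* (x :* e) :+ (con 1 :+ e)
                                           := (con 1 :+ x :* m) :* e :+ con 1) refl m x e ⟩
      (1 + x * m) * e + 1  ≡⟨ cong (λ z → z * e + 1) 1+x*m≡y*d ⟩
      y * suc e * e + 1    ≡⟨ solve 2 (λ y e → y :* (con 1 :+ e) :* e :+ con 1
                                           := con 1 :+ y :* e :* (con 1 :+ e)) refl y e ⟩
      1 + y * e * suc e    ∎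

  %-inverse-^ : ∀ {m x d} .{{_ : NonZero d}} → (m * x) % d ≡ 1 % d →
                ∀ i → (m ^ i * x ^ i) % d ≡ 1 % d
  %-inverse-^ mx≡1 zero = refl
  %-inverse-^ {m} {x} {d} mx≡1 (suc i) = begin
    (m * m ^ i * (x * x ^ i)) % d              ≡⟨ cong (_% d) (solve 4 (λ m M x X →
                                                    m :* M :* (x :* X) := (m :* x) :* (M :* X))
                                                    refl m (m ^ i) x (x ^ i)) ⟩
    (m * x * (m ^ i * x ^ i)) % d              ≡⟨ %-distribˡ-* (m * x) (m ^ i * x ^ i) d ⟩
    ((m * x) % d * ((m ^ i * x ^ i) % d)) % d  ≡⟨ cong₂ (λ a b → (a * b) % d) mx≡1 (%-inverse-^ mx≡1 i) ⟩
    ((1 % d) * (1 % d)) % d                    ≡⟨ %-distribˡ-* 1 1 d ⟨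
    1 % d                                      ∎
    where open ≡-Reasoning

  coprime-divisor-^ : ∀ {m n o} → Coprime m n → ∀ i → m ∣ o * n ^ i → m ∣ o
  coprime-divisor-^ {o = o} m⊥n zero m∣o*1 = subst (_ ∣_) (*-identityʳ o) m∣o*1
  coprime-divisor-^ {m} {n} {o} m⊥n (suc i) m∣o*n^[1+i] = coprime-divisor-^ m⊥n i
    (coprime-divisor m⊥n (subst (m ∣_) (solve 3 (λ o n N → o :* (n :* N) := n :* (o :* N))
                                                  refl o n (n ^ i)) m∣o*n^[1+i]))

open import Defs
open import Data.Nat as ℕ using (ℕ; zero; suc; _^_; _≤_; _<_; _∸_; _*_; _%_; s≤s; >-nonZero)
open import Data.Nat.Properties using (*-assoc; <⇒≱)
open import Data.Nat.Divisibility using (_∣_; m∣m*n; ∣⇒≤)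
open import Data.Nat.Primality using (Prime; prime⇒nonTrivial)
import Data.Nat.Coprimality as Coprime
open import Data.Fin using (toℕ)
open import Data.Integer as ℤ using (ℤ; +_; -_; 1ℤ) renaming (_+_ to _+ℤ_; _-_ to _-ℤ_; _*_ to _*ℤ_)
open import Data.Integer.Properties using (+-0-commutativeMonoid; +-identityˡ; pos-*)
open import Data.Integer.Solver using (module +-*-Solver)
open import Data.Rational using (floor) renaming (_-_ to _-ℚ_)
open import Algebra.Properties.CommutativeMonoid.Sum +-0-commutativeMonoid using (sum-syntax; sum-cong-≗)
open import Data.Product using (proj₁; proj₂)
open import Relation.Nullary using (¬_)
open import Relation.Binary.PropositionalEquality
open FloorDivision
open RationalFloor
open FiniteSums
open Hermite
open ModularPermutation
open PrimeCoprimality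
open +-*-Solver

floor-sum-identity : ∀ n e a P Q → (P * Q) % suc e ≡ 1 % suc e → ¬ (suc n ∣ a * P) →
  floor ((+ (a * P)) // suc n) +ℤ floor ((- (+ (suc e * a * P))) // suc n)
    ≡ sumFrom1 e (λ h → floor (fract ((+ (h * P)) // suc e) -ℚ ((+ (a * P)) // suc n))) -ℤ 1ℤ
floor-sum-identity n e a P Q PQ≡1 N∤A = begin
  floor ((+ A) // N) +ℤ floor (B // N)  ≡⟨ cong₂ _+ℤ_ (floor-/ (+ A) n) (floor-/ B n) ⟩
  L +ℤ B ℤ./ + N                        ≡⟨ cong (L +ℤ_) (hermite e n B) ⟨
  L +ℤ ∑[ j < d ] G (toℕ j)             ≡⟨ cong (L +ℤ_) (∑-*% {d} {P} PQ≡1 G) ⟨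
  L +ℤ ∑[ j < d ] G ((toℕ j * P) % d)   ≡⟨ cong (L +ℤ_) (sum-cong-≗ {d} (λ j → t≡G (toℕ j))) ⟨
  L +ℤ ∑[ j < d ] t (toℕ j)             ≡⟨ cong (L +ℤ_) (sumFrom1+f0≡∑ e t) ⟨
  L +ℤ (sumFrom1 e t +ℤ t 0)            ≡⟨ cong (λ x → L +ℤ (sumFrom1 e t +ℤ x)) t0≡-L-1 ⟩
  L +ℤ (sumFrom1 e t +ℤ (- L -ℤ 1ℤ))    ≡⟨ solve 2 (λ L S → L :+ (S :+ (:- L :- con 1ℤ)) := S :- con 1ℤ)
                                                   refl L (sumFrom1 e t) ⟩
  sumFrom1 e t -ℤ 1ℤ                    ∎
  where
  open ≡-Reasoning
  N = suc n
  d = suc e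
  A = a * P
  B = - (+ (d * a * P))
  L = + A ℤ./ + N

  t : ℕ → ℤ
  t h = floor (fract ((+ (h * P)) // d) -ℚ ((+ A) // N))

  G : ℕ → ℤ
  G r = (+ r *ℤ + N +ℤ B) ℤ./ + (d * N)

  t≡G : ∀ h → t h ≡ G ((h * P) % d)
  t≡G h = trans (floor[fract[k/d]-A/N] (h * P) A e n)
    (cong (λ x → (+ ((h * P) % d) *ℤ + N +ℤ - + x) ℤ./ + (d * N)) (sym (*-assoc d a P)))

  G0*N≡-A*dN : (+ 0 *ℤ + N +ℤ B) *ℤ + N ≡ - (+ A) *ℤ + (d * N)
  G0*N≡-A*dN = begin
    (+ 0 *ℤ + N +ℤ B) *ℤ + N  ≡⟨ cong (_*ℤ + N) (+-identityˡ B) ⟩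
    B *ℤ + N                  ≡⟨ cong (λ x → - x *ℤ + N) (trans (cong +_ (*-assoc d a P)) (pos-* d A)) ⟩
    - (+ d *ℤ + A) *ℤ + N     ≡⟨ solve 3 (λ d A N → :- (d :* A) :* N := :- A :* (d :* N)) refl (+ d) (+ A) (+ N) ⟩
    - (+ A) *ℤ (+ d *ℤ + N)   ≡⟨ cong (- (+ A) *ℤ_) (pos-* d N) ⟨
    - (+ A) *ℤ + (d * N)      ∎

  t0≡-L-1 : t 0 ≡ - L -ℤ 1ℤ
  t0≡-L-1 = begin
    t 0                ≡⟨ t≡G 0 ⟩
    G 0                ≡⟨ /-cross (+ 0 *ℤ + N +ℤ B) (- (+ A)) (n ℕ.+ e * N) n G0*N≡-A*dN ⟩
    (- (+ A)) ℤ./ + N  ≡⟨ [-n]/d≡-[n/d]-1 (+ A) n N∤A ⟩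
    - L -ℤ 1ℤ          ∎

lemma2p6 : (p r d a i : ℕ) → Prime p → ¬ (2 ∣ p) → 1 ≤ r → 2 ≤ d → ¬ (p ∣ d)
    → 1 ≤ a → a ≤ p ^ r ∸ 2 → i < r
    → floor ((+ (a * p ^ i)) // (p ^ r ∸ 1))
        +ℤ floor ((- (+ (d * a * p ^ i))) // (p ^ r ∸ 1))
      ≡ sumFrom1 (d ∸ 1)
          (λ h → floor (fract ((+ (h * p ^ i)) // d)
                         -ℚ ((+ (a * p ^ i)) // (p ^ r ∸ 1))))
        -ℤ + 1
lemma2p6 _ zero _ _ _ _ _ () _ _ _ _ _
lemma2p6 _ _ zero _ _ _ _ _ () _ _ _ _
lemma2p6 p (suc r) (suc e) a i p-prime _ _ _ p∤d 1≤a a≤q-2 _ with p ^ suc r in pʳ≡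
lemma2p6 _ _ _ (suc _) _ _ _ _ _ _ _ () _ | zero
lemma2p6 _ _ _ (suc _) _ _ _ _ _ _ _ () _ | suc zero
... | suc (suc n) = floor-sum-identity n e a (p ^ i) (x ^ i) (%-inverse-^ px≡1 i) N∤a*pⁱ
  where
  instance _ = prime⇒nonTrivial p-prime
  inverse = coprime⇒%-inverse (prime∤⇒coprime p-prime p∤d)
  x = proj₁ inverse
  px≡1 = proj₂ inverse
  p∤N : ¬ (p ∣ suc n)
  p∤N = ∣suc⇒∤ (subst (p ∣_) pʳ≡ (m∣m*n (p ^ r)))
  N∤a*pⁱ : ¬ (suc n ∣ a * p ^ i)
  N∤a*pⁱ N∣a*pⁱ = <⇒≱ (s≤s a≤q-2) (∣⇒≤ {{>-nonZero 1≤a}}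
    (coprime-divisor-^ (Coprime.sym (prime∤⇒coprime p-prime p∤N)) i N∣a*pⁱ))
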